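{- Let $A$ be an infinite recursively enumerable class of sequences, given by a total recursive $\phi_a$ whose range consists of indices $s$ of total recursive functions $\phi_s$ (each generating the sequence $S_s(n)=\phi_s(n)$). Let $P_p$ be a property over $A$ that is Computable in the Limit, computed by $\phi_p(x,t)=\phi_q(\langle\phi_x(0),\dots,\phi_x(t)\rangle)$ for some partial recursive $\phi_q$. Then there is a property $P_{p'}$ over the class $A_Z$, Computable in the Limit, such that for every $x$ there exists $y$ with $P_p(x)=P_{p'}(y)$.
   Context: $\tau(x,y)=\frac12(x^2+2xy+y^2+3x+y)$, $\tau^{k+1}(x_1,\dots,x_{k+1})=\tau(\tau^k(x_1,\dots,x_k),x_{k+1})$, $\tau^1(x)=x$; a finite sequence is coded as $\langle S(0),\dots,S(n)\rangle=\tau^{n+2}(n,S(0),\dots,S(n))$. $\phi_i$ is the $i$-th partial recursive function and $\phi_i(x,y)$ means $\phi_i(\tau(x,y))$. A property $P_p$ over a class of sequences (indexed by $s$) is computed by a partial recursive $\phi_p(s,t)$; $P_p(s)=x$ ("$P_p$ l-converges to $x$") means there is $u$ with $\phi_p(s,u)=x$ and for all $t>u$, if $\phi_p(s,t)$ converges then $\phi_p(s,t)=x$; otherwise $P_p(s)$ l-diverges. Such a property is called Computable in the Limit. $A_Z$ is the class of constant sequences: there is a total recursive $\phi_Z$ such that for every $x$, $\phi_{\phi_Z(x)}(n)=x$ for all $n$; so the sequence with index $\phi_Z(x)$ is $\langle x,x,x,\dots\rangle$, and $\phi_Z^{ -1}(y)=\phi_y(0)$. -}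

module Defs where

open import Data.Nat using (ℕ; zero; suc; _+_; _*_; _/_; _≤_; _<_)
open import Data.Product using (_×_; _,_; proj₁; proj₂; ∃; Σ)
open import Data.List using (List; []; _∷_; foldl; map; upTo)
open import Data.Maybe using (Maybe; just; nothing)
open import Relation.Binary.PropositionalEquality using (_≡_)
open import Function.Bundles using (_⇔_)

-- The pairing function τ(x,y) = ½(x²+2xy+y²+3x+y)  (always even numerator)

τ : ℕ → ℕ → ℕ
τ x y = (x * x + 2 * x * y + y * y + 3 * x + y) / 2

-- inverse of τ, by enumerating pairs in the order of their τ-codes:
-- τ(x,0)+1 = τ(0,x+1),  τ(x,y+1)+1 = τ(x+1,y)
untauNext : ℕ × ℕ → ℕ × ℕ
untauNext (x , zero)  = (0 , suc x)
untauNext (x , suc y) = (suc x , y)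

untau : ℕ → ℕ × ℕ
untau zero    = (0 , 0)
untau (suc n) = untauNext (untau n)

-- ⟨S(0),…,S(n)⟩ = τ^{n+2}(n, S(0), …, S(n)),  with
-- τ^{k+1}(x₁,…,x_{k+1}) = τ(τ^k(x₁,…,x_k), x_{k+1}) , i.e. a left fold
seqCode : ℕ → (ℕ → ℕ) → ℕ
seqCode n S = foldl τ n (map S (upTo (suc n)))

-- Partial recursive functions: μ-recursive codes (arity implicit in use)

data Code : Set where
  zeroC : Code
  succC : Code
  projC : ℕ → Code                -- i-th argument (from 0)
  compC : Code → List Code → Code
  precC : Code → Code → Code      -- primitive recursion on first argument
  muC   : Code → Code

nth : List ℕ → ℕ → Maybe ℕ
nth []       _       = nothing
nth (x ∷ xs) zero    = just x
nth (x ∷ xs) (suc i) = nth xs i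

mutual
  data Eval : Code → List ℕ → ℕ → Set where
    zeroE : ∀ {xs} → Eval zeroC xs 0
    succE : ∀ {x xs} → Eval succC (x ∷ xs) (suc x)
    projE : ∀ {i xs v} → nth xs i ≡ just v → Eval (projC i) xs v
    compE : ∀ {f gs xs ys v} → EvalList gs xs ys → Eval f ys v →
            Eval (compC f gs) xs v
    precZ : ∀ {f g xs v} → Eval f xs v → Eval (precC f g) (0 ∷ xs) v
    precS : ∀ {f g n xs w v} → Eval (precC f g) (n ∷ xs) w →
            Eval g (n ∷ w ∷ xs) v → Eval (precC f g) (suc n ∷ xs) v
    muE   : ∀ {f xs n} → Eval f (n ∷ xs) 0 →
            (∀ m → m < n → ∃ λ k → Eval f (m ∷ xs) (suc k)) →
            Eval (muC f) xs n

  data EvalList : List Code → List ℕ → List ℕ → Set where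
    []E  : ∀ {xs} → EvalList [] xs []
    _∷E_ : ∀ {g gs xs y ys} → Eval g xs y → EvalList gs xs ys →
           EvalList (g ∷ gs) xs (y ∷ ys)

-- Gödel numbering ℕ → Code (fuel argument only for termination;
-- fuel n suffices for index n, so every code has an index)
mutual
  decode : ℕ → ℕ → Code
  decode zero    _ = zeroC
  decode (suc f) n = decTag f (proj₁ (untau n)) (proj₂ (untau n))

  decTag : ℕ → ℕ → ℕ → Code
  decTag f 0 r = zeroC
  decTag f 1 r = succC
  decTag f 2 r = projC r
  decTag f 3 r = compC (decode f (proj₁ (untau r))) (decodeList f (proj₂ (untau r)))
  decTag f 4 r = precC (decode f (proj₁ (untau r))) (decode f (proj₂ (untau r)))
  decTag f 5 r = muC (decode f r)
  decTag f _ r = zeroC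

  decodeList : ℕ → ℕ → List Code
  decodeList zero    _       = []
  decodeList (suc f) zero    = []
  decodeList (suc f) (suc k) =
    decode f (proj₁ (untau k)) ∷ decodeList f (proj₂ (untau k))

φ : ℕ → ℕ → ℕ → Set
φ i x v = Eval (decode i i) (x ∷ []) v

φ₂ : ℕ → ℕ → ℕ → ℕ → Set
φ₂ i x y v = φ i (τ x y) v

Total : ℕ → Set
Total i = ∀ x → ∃ λ v → φ i x v

LConv : ℕ → ℕ → ℕ → Set
LConv p s x = ∃ λ u → φ₂ p s u x × (∀ t → u < t → ∀ w → φ₂ p s t w → w ≡ x)

SameLimit : ℕ → ℕ → ℕ → ℕ → Set
SameLimit p s p' s' = ∀ x → LConv p s x ⇔ LConv p' s' x

InClass : ℕ → ℕ → Set
InClass a s = ∃ λ i → φ a i s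

module Submission where

-- The hypotheses on φ_Z make x ↦ φ_Z(x) a total recursive
-- injection (φ_{φ_Z(x)}(0) = x recovers x).  A recursive injection can be
-- inverted by unbounded search, so there is a partial recursive G with
-- G(τ(φ_Z(x), t)) = τ(x, t) for all x and t.  The property p' := φ_p ∘ G
-- then computes, at the index y = φ_Z(x) and time t, exactly what φ_p
-- computes at x and time t, so P_p'(y) and P_p(x) have the same l-limit.

open import Defs
open import Data.Nat
  using (ℕ; zero; suc; _+_; _*_; _∸_; _/_; _≤_; _<_; z≤n; s≤s; pred; _≟_)
open import Data.Nat.Properties
open import Data.Nat.DivMod using (m*n/n≡m)
open import Data.Nat.Induction using (<-rec)
open import Data.Nat.Tactic.RingSolver using (solve-∀)
open import Data.Product using (_×_; _,_; proj₁; proj₂; ∃)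
open import Data.List using (List; []; _∷_)
open import Data.Sum using (inj₁; inj₂)
open import Data.Empty using (⊥-elim)
open import Relation.Binary.PropositionalEquality
open import Relation.Binary.Definitions using (tri<; tri≈; tri>)
open import Relation.Nullary using (yes; no)
open import Function.Bundles using (_⇔_; mk⇔; Equivalence)

-- 1. The pairing function

T : ℕ → ℕ
T zero    = 0
T (suc s) = T s + suc s

T-double : ∀ s → T s + T s ≡ s * suc s
T-double zero    = refl
T-double (suc s) = begin
  (T s + suc s) + (T s + suc s)  ≡⟨ regroup (T s) s ⟩
  (T s + T s) + (suc s + suc s)  ≡⟨ cong (_+ (suc s + suc s)) (T-double s) ⟩
  s * suc s + (suc s + suc s)    ≡⟨ step s ⟩
  suc s * suc (suc s)            ∎
  where
  open ≡-Reasoning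
  regroup : ∀ a b → (a + suc b) + (a + suc b) ≡ (a + a) + (suc b + suc b)
  regroup = solve-∀
  step : ∀ s → s * suc s + (suc s + suc s) ≡ suc s * suc (suc s)
  step = solve-∀

T-≥ : ∀ s → s ≤ T s
T-≥ zero    = z≤n
T-≥ (suc s) = m≤n+m (suc s) (T s)

-- τ enumerates the pairs diagonal by diagonal: τ(x,y) = T(x+y) + x.
τ-triangular : ∀ x y → τ x y ≡ T (x + y) + x
τ-triangular x y = trans (cong (_/ 2) numerator) (m*n/n≡m (T (x + y) + x) 2)
  where
  expand : ∀ x y → x * x + 2 * x * y + y * y + 3 * x + y ≡ (x + y) * suc (x + y) + (x + x)
  expand = solve-∀
  collect : ∀ t x → (t + t) + (x + x) ≡ (t + x) * 2
  collect = solve-∀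
  numerator : x * x + 2 * x * y + y * y + 3 * x + y ≡ (T (x + y) + x) * 2
  numerator = trans (expand x y)
    (trans (cong (_+ (x + x)) (sym (T-double (x + y)))) (collect (T (x + y)) x))

mutual
  untau-diagonal-start : ∀ s → untau (T s) ≡ (0 , s)
  untau-diagonal-start zero = refl
  untau-diagonal-start (suc s)
    rewrite +-suc (T s) s | untau-diagonal s s ≤-refl | n∸n≡0 s = refl

  untau-diagonal : ∀ s k → k ≤ s → untau (T s + k) ≡ (k , s ∸ k)
  untau-diagonal s zero _ rewrite +-identityʳ (T s) = untau-diagonal-start s
  untau-diagonal s (suc k) k<s
    rewrite +-suc (T s) k | untau-diagonal s k (<⇒≤ k<s) | +-∸-assoc 1 k<s = refl

untau-τ : ∀ a b → untau (τ a b) ≡ (a , b)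
untau-τ a b rewrite τ-triangular a b | untau-diagonal (a + b) a (m≤m+n a b)
  | m+n∸m≡n a b = refl

τ-injective : ∀ {a b c d} → τ a b ≡ τ c d → a ≡ c × b ≡ d
τ-injective {a} {b} {c} {d} e
  with trans (sym (untau-τ a b)) (trans (cong untau e) (untau-τ c d))
... | refl = refl , refl

τ-bound : ∀ a b → a + b ≤ τ a b
τ-bound a b rewrite τ-triangular a b = ≤-trans (T-≥ (a + b)) (m≤m+n (T (a + b)) a)

components-≤ : ∀ {a b n} → τ a b ≤ n → a ≤ n × b ≤ n
components-≤ {a} {b} h =
  ≤-trans (m≤m+n a b) (≤-trans (τ-bound a b) h) ,
  ≤-trans (m≤n+m b a) (≤-trans (τ-bound a b) h)

-- 2. Every code has an index

Codes : Code → ℕ → Set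
Codes C n = ∀ f → n ≤ f → decode f n ≡ C

CodesList : List Code → ℕ → Set
CodesList gs n = ∀ f → n ≤ f → decodeList f n ≡ gs

decode-tagged : ∀ k r f → τ (suc k) r ≤ f →
                ∃ λ g → r ≤ g × decode f (τ (suc k) r) ≡ decTag g (suc k) r
decode-tagged k r zero h with ≤-trans (τ-bound (suc k) r) h
... | ()
decode-tagged k r (suc g) h =
  g , ≤-pred (≤-trans (s≤s (m≤n+m r k)) (≤-trans (τ-bound (suc k) r) h)) ,
  cong (λ c → decTag g (proj₁ c) (proj₂ c)) (untau-τ (suc k) r)

decode-pair : ∀ g i j → decode g (proj₁ (untau (τ i j))) ≡ decode g i ×
                        proj₂ (untau (τ i j)) ≡ j
decode-pair g i j rewrite untau-τ i j = refl , refl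

mutual
  codes : ∀ C → ∃ (Codes C)
  codes zeroC = 0 , λ { zero _ → refl ; (suc f) _ → refl }
  codes succC = τ 1 0 , λ f h → proj₂ (proj₂ (decode-tagged 0 0 f h))
  codes (projC i) = τ 2 i , λ f h → proj₂ (proj₂ (decode-tagged 1 i f h))
  codes (compC c gs) with codes c | codesList gs
  ... | i , Ci | j , Cj = τ 3 (τ i j) , λ f h →
    let (g , ij≤g , e) = decode-tagged 2 (τ i j) f h
        (i≤g , j≤g) = components-≤ ij≤g
    in trans e (cong₂ compC (trans (proj₁ (decode-pair g i j)) (Ci g i≤g))
                            (trans (cong (decodeList g) (proj₂ (decode-pair g i j))) (Cj g j≤g)))
  codes (precC c d) with codes c | codes d
  ... | i , Ci | j , Cj = τ 4 (τ i j) , λ f h →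
    let (g , ij≤g , e) = decode-tagged 3 (τ i j) f h
        (i≤g , j≤g) = components-≤ ij≤g
    in trans e (cong₂ precC (trans (proj₁ (decode-pair g i j)) (Ci g i≤g))
                            (trans (cong (decode g) (proj₂ (decode-pair g i j))) (Cj g j≤g)))
  codes (muC c) with codes c
  ... | i , Ci = τ 5 i , λ f h →
    let (g , i≤g , e) = decode-tagged 4 i f h in trans e (cong muC (Ci g i≤g))

  codesList : ∀ gs → ∃ (CodesList gs)
  codesList [] = 0 , λ { zero _ → refl ; (suc f) _ → refl }
  codesList (c ∷ gs) with codes c | codesList gs
  ... | i , Ci | j , Cj = suc (τ i j) , λ
    { (suc g) (s≤s ij≤g) →
        let (i≤g , j≤g) = components-≤ ij≤g
        in cong₂ _∷_ (trans (proj₁ (decode-pair g i j)) (Ci g i≤g))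
                     (trans (cong (decodeList g) (proj₂ (decode-pair g i j))) (Cj g j≤g)) }

index : ∀ C → ∃ λ n → decode n n ≡ C
index C = proj₁ (codes C) , proj₂ (codes C) (proj₁ (codes C)) ≤-refl

-- 3. Evaluation is deterministic

mutual
  eval-det : ∀ {c xs v w} → Eval c xs v → Eval c xs w → v ≡ w
  eval-det zeroE zeroE = refl
  eval-det succE succE = refl
  eval-det (projE e) (projE e') with trans (sym e) e'
  ... | refl = refl
  eval-det (compE l e) (compE l' e') with evalList-det l l'
  ... | refl = eval-det e e'
  eval-det (precZ e) (precZ e') = eval-det e e'
  eval-det (precS e g) (precS e' g') with eval-det e e'
  ... | refl = eval-det g g'
  eval-det (muE {n = n} e h) (muE {n = n'} e' h') with <-cmp n n'
  ... | tri≈ _ n≡n' _ = n≡n'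
  ... | tri< n<n' _ _ = ⊥-elim (0≢1+n (eval-det e (proj₂ (h' n n<n'))))
  ... | tri> _ _ n'<n = ⊥-elim (0≢1+n (sym (eval-det (proj₂ (h n' n'<n)) e')))

  evalList-det : ∀ {gs xs vs ws} → EvalList gs xs vs → EvalList gs xs ws → vs ≡ ws
  evalList-det []E []E = refl
  evalList-det (e ∷E l) (e' ∷E l') = cong₂ _∷_ (eval-det e e') (evalList-det l l')

-- 4. Arithmetic programs

addC : Code
addC = precC (projC 0) (compC succC (projC 1 ∷ []))

add-eval : ∀ x y → Eval addC (x ∷ y ∷ []) (x + y)
add-eval zero    y = precZ (projE refl)
add-eval (suc x) y = precS (add-eval x y) (compE (projE refl ∷E []E) succE)

mulC : Code
mulC = precC zeroC (compC addC (projC 1 ∷ projC 2 ∷ []))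

mul-eval : ∀ x y → Eval mulC (x ∷ y ∷ []) (x * y)
mul-eval zero    y = precZ zeroE
mul-eval (suc x) y = subst (Eval mulC (suc x ∷ y ∷ [])) (+-comm (x * y) y)
  (precS (mul-eval x y) (compE (projE refl ∷E (projE refl ∷E []E)) (add-eval (x * y) y)))

predC : Code
predC = precC zeroC (projC 0)

pred-eval : ∀ x → Eval predC (x ∷ []) (pred x)
pred-eval zero    = precZ zeroE
pred-eval (suc x) = precS (pred-eval x) (projE refl)

subC : Code
subC = precC (projC 0) (compC predC (projC 1 ∷ []))

sub-eval : ∀ k m → Eval subC (k ∷ m ∷ []) (m ∸ k)
sub-eval zero    m = precZ (projE refl)
sub-eval (suc k) m = subst (Eval subC (suc k ∷ m ∷ [])) (pred[m∸n]≡m∸[1+n] m k)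
  (precS (sub-eval k m) (compE (projE refl ∷E []E) (pred-eval (m ∸ k))))

TC : Code
TC = precC zeroC (compC addC (projC 1 ∷ succC ∷ []))

T-eval : ∀ s → Eval TC (s ∷ []) (T s)
T-eval zero    = precZ zeroE
T-eval (suc s) = precS (T-eval s)
  (compE (projE refl ∷E (succE ∷E []E)) (add-eval (T s) (suc s)))

-- tauC (x, y) = τ(x, y), through τ(x,y) = T(x+y) + x
tauC : Code
tauC = compC addC (compC TC (addC ∷ []) ∷ projC 0 ∷ [])

τ-eval : ∀ x y → Eval tauC (x ∷ y ∷ []) (τ x y)
τ-eval x y = subst (Eval tauC (x ∷ y ∷ [])) (sym (τ-triangular x y))
  (compE (compE (add-eval x y ∷E []E) (T-eval (x + y)) ∷E (projE refl ∷E []E))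
         (add-eval (T (x + y)) x))

dist : ℕ → ℕ → ℕ
dist u v = (u ∸ v) + (v ∸ u)

dist-self : ∀ u → dist u u ≡ 0
dist-self u rewrite n∸n≡0 u = refl

dist-zero : ∀ u v → dist u v ≡ 0 → u ≡ v
dist-zero u v e = ≤-antisym (m∸n≡0⇒m≤n (m+n≡0⇒m≡0 (u ∸ v) e))
                            (m∸n≡0⇒m≤n (m+n≡0⇒n≡0 (u ∸ v) e))

distC : Code
distC = compC addC (compC subC (projC 1 ∷ projC 0 ∷ []) ∷
                    compC subC (projC 0 ∷ projC 1 ∷ []) ∷ [])

dist-eval : ∀ u v → Eval distC (u ∷ v ∷ []) (dist u v)
dist-eval u v = compE
  (compE (projE refl ∷E (projE refl ∷E []E)) (sub-eval v u) ∷E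
   (compE (projE refl ∷E (projE refl ∷E []E)) (sub-eval u v) ∷E []E))
  (add-eval (u ∸ v) (v ∸ u))

-- 5. Minimisation

mu-eval : ∀ {f xs n} → Eval f (n ∷ xs) 0 →
          (∀ m → m < n → ∃ λ v → Eval f (m ∷ xs) v × v ≢ 0) → Eval (muC f) xs n
mu-eval {f} {xs} zero-at-n nonzero-below = muE zero-at-n λ m m<n →
  let (v , ev , v≢0) = nonzero-below m m<n in pos v v≢0 ev
  where
  pos : ∀ {m} v → v ≢ 0 → Eval f (m ∷ xs) v → ∃ λ k → Eval f (m ∷ xs) (suc k)
  pos zero    v≢0 _  = ⊥-elim (v≢0 refl)
  pos (suc k) _   ev = k , ev

LeastZero : (ℕ → ℕ) → ℕ → Set
LeastZero val n = val n ≡ 0 × (∀ m → m < n → val m ≢ 0)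

least-zero : (val : ℕ → ℕ) → ∀ N → val N ≡ 0 → ∃ (LeastZero val)
least-zero val = <-rec (λ N → val N ≡ 0 → ∃ (LeastZero val)) search
  where
  search : ∀ N → (∀ {m} → m < N → val m ≡ 0 → ∃ (LeastZero val)) →
           val N ≡ 0 → ∃ (LeastZero val)
  search N smaller zero-at-N with anyUpTo? (λ m → val m ≟ 0) N
  ... | yes (m , m<N , zero-at-m) = smaller m<N zero-at-m
  ... | no none = N , zero-at-N , λ m m<N zero-at-m → none (m , m<N , zero-at-m)

mu-converges : ∀ f xs (val : ℕ → ℕ) → (∀ b → Eval f (b ∷ xs) (val b)) →
               ∀ N → val N ≡ 0 → ∃ λ n → Eval (muC f) xs n
mu-converges f xs val ev N zero-at-N =
  let (n , zero-at-n , nonzero-below) = least-zero val N zero-at-N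
  in n , mu-eval (subst (Eval f (n ∷ xs)) zero-at-n (ev n))
                 (λ m m<n → val m , ev m , nonzero-below m m<n)

-- 6. Inverting a recursive injection on the first component of a pair

module Inversion (F : Code) (f : ℕ → ℕ) (F-eval : ∀ a → Eval F (a ∷ []) (f a))
                 (f-injective : ∀ a a' → f a ≡ f a' → a ≡ a') where

  -- secondC (a, n) = least b with τ(f a, b) = n or b > n; the bound b > n
  -- makes the search total, since b ≤ τ(f a, b).
  secondTest : ℕ → ℕ → ℕ → ℕ
  secondTest a n b = dist (τ (f a) b) n * (suc n ∸ b)

  secondTestC : Code
  secondTestC = compC mulC
    (compC distC (compC tauC (compC F (projC 1 ∷ []) ∷ projC 0 ∷ []) ∷ projC 2 ∷ []) ∷
     compC subC (projC 0 ∷ compC succC (projC 2 ∷ []) ∷ []) ∷ [])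

  secondTest-eval : ∀ b a n → Eval secondTestC (b ∷ a ∷ n ∷ []) (secondTest a n b)
  secondTest-eval b a n = compE
    (compE (compE (compE (projE refl ∷E []E) (F-eval a) ∷E (projE refl ∷E []E)) (τ-eval (f a) b) ∷E
            (projE refl ∷E []E)) (dist-eval (τ (f a) b) n) ∷E
     (compE (projE refl ∷E (compE (projE refl ∷E []E) succE ∷E []E)) (sub-eval b (suc n)) ∷E []E))
    (mul-eval _ _)

  secondC : Code
  secondC = muC secondTestC

  second-converges : ∀ a n → ∃ λ b → Eval secondC (a ∷ n ∷ []) b
  second-converges a n = mu-converges secondTestC (a ∷ n ∷ []) (secondTest a n)
    (λ b → secondTest-eval b a n) (suc n)
    (trans (cong (dist (τ (f a) (suc n)) n *_) (n∸n≡0 (suc n))) (*-zeroʳ (dist (τ (f a) (suc n)) n)))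

  second-correct : ∀ x t → Eval secondC (x ∷ τ (f x) t ∷ []) t
  second-correct x t = mu-eval
    (subst (Eval secondTestC (t ∷ x ∷ n ∷ [])) (cong (_* (suc n ∸ t)) (dist-self n))
           (secondTest-eval t x n))
    (λ m m<t → secondTest x n m , secondTest-eval m x n , nonzero m<t)
    where
    n : ℕ
    n = τ (f x) t
    nonzero : ∀ {m} → m < t → secondTest x n m ≢ 0
    nonzero {m} m<t e with m*n≡0⇒m≡0∨n≡0 (dist (τ (f x) m) n) e
    ... | inj₁ same = <⇒≢ m<t (proj₂ (τ-injective {f x} {m} {f x} {t} (dist-zero (τ (f x) m) n same)))
    ... | inj₂ beyond = <⇒≱ (≤-trans m<t (proj₂ (components-≤ {f x} ≤-refl)))
                            (<⇒≤ (m∸n≡0⇒m≤n {suc n} beyond))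

  -- firstC n = least a with τ(f a, secondC(a, n)) = n.
  firstTestC : Code
  firstTestC = compC distC
    (compC tauC (compC F (projC 0 ∷ []) ∷ secondC ∷ []) ∷ projC 1 ∷ [])

  firstTest-eval : ∀ a n b → Eval secondC (a ∷ n ∷ []) b →
                   Eval firstTestC (a ∷ n ∷ []) (dist (τ (f a) b) n)
  firstTest-eval a n b eb = compE
    (compE (compE (projE refl ∷E []E) (F-eval a) ∷E (eb ∷E []E)) (τ-eval (f a) b) ∷E
     (projE refl ∷E []E)) (dist-eval (τ (f a) b) n)

  firstC : Code
  firstC = muC firstTestC

  first-correct : ∀ x t → Eval firstC (τ (f x) t ∷ []) x
  first-correct x t = mu-eval
    (subst (Eval firstTestC (x ∷ n ∷ [])) (dist-self n) (firstTest-eval x n t (second-correct x t)))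
    λ m m<x → let (b , eb) = second-converges m n in
      dist (τ (f m) b) n , firstTest-eval m n b eb ,
      λ d → <⇒≢ m<x (f-injective m x (proj₁ (τ-injective (dist-zero _ _ d))))
    where
    n : ℕ
    n = τ (f x) t

  G : Code
  G = compC tauC (firstC ∷ compC secondC (firstC ∷ projC 0 ∷ []) ∷ [])

  G-correct : ∀ x t → Eval G (τ (f x) t ∷ []) (τ x t)
  G-correct x t = compE
    (first-correct x t ∷E (compE (first-correct x t ∷E (projE refl ∷E []E)) (second-correct x t) ∷E []E))
    (τ-eval x t)

-- 7. Precomposition preserves l-limits

sameLimit-of-sameGraph : ∀ {p s p' s'} → (∀ t w → φ₂ p s t w ⇔ φ₂ p' s' t w) →
                         SameLimit p s p' s'
sameLimit-of-sameGraph graph v = mk⇔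
  (λ (u , hit , stable) → u , to (graph u v) hit ,
     λ t u<t w h → stable t u<t w (from (graph t w) h))
  (λ (u , hit , stable) → u , from (graph u v) hit ,
     λ t u<t w h → stable t u<t w (to (graph t w) h))
  where open Equivalence

precompose : ∀ p G → ∃ λ p' → ∀ x y → (∀ t → Eval G (τ y t ∷ []) (τ x t)) →
             SameLimit p x p' y
precompose p G = p' , λ x y G-xy → sameLimit-of-sameGraph {p} {x} {p'} {y} λ t w → mk⇔
  (λ h → subst (λ C → Eval C (τ y t ∷ []) w) (sym p'-codes) (compE (G-xy t ∷E []E) h))
  (λ h → back (G-xy t) (subst (λ C → Eval C (τ y t ∷ []) w) p'-codes h))
  where
  p' : ℕ
  p' = proj₁ (index (compC (decode p p) (G ∷ [])))
  p'-codes : decode p' p' ≡ compC (decode p p) (G ∷ [])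
  p'-codes = proj₂ (index (compC (decode p p) (G ∷ [])))
  back : ∀ {n m w} → Eval G (n ∷ []) m → Eval (compC (decode p p) (G ∷ [])) (n ∷ []) w →
         Eval (decode p p) (m ∷ []) w
  back eG (compE (eG' ∷E []E) e) = subst (λ m → Eval (decode p p) (m ∷ []) _) (eval-det eG' eG) e

mainTheorem2 : (a p q : ℕ) →
    Total a →
    (∀ s → InClass a s → Total s) →
    (∀ n → ∃ λ s → InClass a s × n ≤ s) →
    (∀ x t v → φ₂ p x t v ⇔
    (∃ λ (S : ℕ → ℕ) → (∀ i → i ≤ t → φ x i (S i)) × φ q (seqCode t S) v)) →
    (Z : ℕ) → Total Z →
    (∀ x z → φ Z x z → ∀ n → φ z n x) →
    ∃ λ p' → ∀ x → InClass a x →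
    ∃ λ y → (∃ λ z → φ Z z y) × SameLimit p x p' y
mainTheorem2 a p q _ _ _ _ Z Z-total Z-constant =
  p' , λ x _ → z x , (x , z-eval x) , transfer x (z x) (G-correct x)
  where
  z : ℕ → ℕ
  z x = proj₁ (Z-total x)
  z-eval : ∀ x → φ Z x (z x)
  z-eval x = proj₂ (Z-total x)
  -- φ_Z is injective: the sequence φ_Z(x) starts with x.
  z-injective : ∀ x x' → z x ≡ z x' → x ≡ x'
  z-injective x x' e = eval-det (subst (λ y → φ y 0 x) e (Z-constant x (z x) (z-eval x) 0))
                                (Z-constant x' (z x') (z-eval x') 0)
  open Inversion (decode Z Z) z z-eval z-injective using (G; G-correct)
  p' : ℕ
  p' = proj₁ (precompose p G)
  transfer : ∀ x y → (∀ t → Eval G (τ y t ∷ []) (τ x t)) → SameLimit p x p' y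
  transfer = proj₂ (precompose p G)
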